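{- Let $A = \{a_1 < a_2 < \cdots\}$ and $B = \{b_1 < b_2 < \cdots\}$ be two sequences of positive integers with $1 < b_1$ such that $P(A) = \mathbb{N} \setminus B$. Let $k$ be the index with $P(\{a_1, \dots, a_k\}) = [0, b_1 - 1]$. If $b_2 \geq 3b_1 + 5$, then (i) $a_{k+1} = b_1 + 1$, $a_{k+2} \leq 2b_1 + 1$, $a_{k+3} \leq a_{k+2} + b_1$, and $b_2 \geq a_{k+3} + a_{k+2} + b_1$; (ii) $P(\{a_1, \dots, a_{k+3}\}) = [0, a_{k+3} + a_{k+2} + 2b_1] \setminus \{b_1,\ a_{k+3} + a_{k+2} + b_1\}$.
   Context: $\mathbb{N}$ denotes the set of all nonnegative integers. For a set $A$ of positive integers, $P(A) = \{\sum \varepsilon_i a_i : a_i \in A,\ \varepsilon_i \in \{0,1\},\ \sum \varepsilon_i < \infty\}$ is the set of all finite subset sums of $A$ (including $0$ as the empty sum). For integers $x \le y$, $[x, y]$ denotes the set of integers $n$ with $x \leq n \leq y$. (The index $k$ is the one with $a_k < b_1 < a_{k+1}$.) -}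

module Defs where

open import Data.Nat using (ℕ; _+_; _<_)
open import Data.List using (List; map)
open import Data.Nat.ListAction using (sum)
open import Data.List.Relation.Unary.All using (All)
open import Data.List.Relation.Unary.Unique.Propositional using (Unique)
open import Data.Product using (Σ; ∃; _×_)
open import Relation.Binary.PropositionalEquality using (_≡_)
open import Data.Unit using (⊤)

-- Sequences are 0-indexed: a i is the paper's a_{i+1}.

StrictlyIncreasing : (ℕ → ℕ) → Set
StrictlyIncreasing a = ∀ i → a i < a (1 + i)

InSeq : (ℕ → ℕ) → ℕ → Set
InSeq b n = ∃ λ j → b j ≡ n

SubsetSum : (ℕ → ℕ) → (ℕ → Set) → ℕ → Set
SubsetSum a I n =
  Σ (List ℕ) λ is → Unique is × All I is × sum (map a is) ≡ n

InP : (ℕ → ℕ) → ℕ → Set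
InP a n = SubsetSum a (λ _ → ⊤) n

InPFirst : (ℕ → ℕ) → ℕ → ℕ → Set
InPFirst a m n = SubsetSum a (λ i → i < m) n

{-# OPTIONS --safe #-}
module Submission where

-- Write Pₘ for the subset sums of the first m terms of a, and c = b 0.  Since
-- Pₘ₊₁ = Pₘ ∪ (a m + Pₘ), each new term adjoins a shifted copy of the current set.
-- Every n < b 1 other than c lies in P(A), and a subset sum below a m only uses
-- terms of index < m; hence a m is at most any such n missing from Pₘ.  This
-- bounds a k, a (1 + k), a (2 + k) from above, while c ∉ P(A) forces c < a k.
-- Three shifts then give
--   Pₖ₊₁ = [0, 2c] ∖ {c},   Pₖ₊₂ = [0, d + 2c] ∖ {c, d + c},
--   Pₖ₊₃ = [0, e + d + 2c] ∖ {c, e + d + c}   (d = a (1 + k), e = a (2 + k)),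
-- and since b 1 ∉ Pₖ₊₃ and b 1 > c, b 1 ≥ e + d + c.

open import Defs
open import Data.Nat using (ℕ; zero; suc; _+_; _*_; _≤_; _<_; z≤n; s≤s; z<s; s≤s⁻¹)
open import Data.Nat.Properties
open import Data.Nat.ListAction using (sum)
open import Data.Nat.Tactic.RingSolver using (solve-∀)
open import Algebra.Properties.CommutativeSemigroup +-commutativeSemigroup using (x∙yz≈y∙xz)
open import Data.List using ([]; _∷_; map)
open import Data.List.Membership.Propositional using (_∈_; _─_)
open import Data.List.Membership.DecPropositional _≟_ using (_∈?_)
open import Data.List.Relation.Unary.All as All using (All; []; _∷_)
open import Data.List.Relation.Unary.All.Properties as All using (¬Any⇒All¬)
open import Data.List.Relation.Unary.AllPairs using ([]; _∷_)
open import Data.List.Relation.Unary.Any using (here; there)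
open import Data.List.Relation.Unary.Unique.Propositional using (Unique)
open import Data.Product as Product using (_×_; _,_; ∃-syntax; proj₁; proj₂)
open import Data.Sum as Sum using (_⊎_; inj₁; inj₂; [_,_])
open import Data.Unit using (tt)
open import Function using (_⇔_; mk⇔; Equivalence; _∘_)
open import Function.Construct.Composition using (_⇔-∘_)
open import Relation.Nullary using (¬_; yes; no)
open import Relation.Nullary.Decidable using (_×-dec_; ¬?)
open import Relation.Unary using (Decidable)
open import Relation.Binary.PropositionalEquality using (_≡_; _≢_; refl; sym; trans; cong; subst; subst₂; ≢-sym)

open Equivalence

strictlyIncreasing⇒mono-≤ : ∀ {a} → StrictlyIncreasing a → ∀ {i j} → i ≤ j → a i ≤ a j
strictlyIncreasing⇒mono-≤ a↑ {j = zero} z≤n = ≤-refl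
strictlyIncreasing⇒mono-≤ a↑ {j = suc j} i≤1+j with m≤n⇒m<n∨m≡n i≤1+j
... | inj₁ (s≤s i≤j) = ≤-trans (strictlyIncreasing⇒mono-≤ a↑ i≤j) (<⇒≤ (a↑ j))
... | inj₂ refl      = ≤-refl

summands≤sum : ∀ (a : ℕ → ℕ) is → All (λ i → a i ≤ sum (map a is)) is
summands≤sum a []       = []
summands≤sum a (i ∷ is) =
  m≤m+n (a i) _ ∷ All.map (λ le → ≤-trans le (m≤n+m _ (a i))) (summands≤sum a is)

module _ {A : Set} {x : A} where

  Unique-─ : ∀ {xs} (x∈xs : x ∈ xs) → Unique xs → Unique (xs ─ x∈xs)
  Unique-─ (here _)     (_ ∷ u)   = u
  Unique-─ (there x∈xs) (y∉ ∷ u) = All.─⁺ x∈xs y∉ ∷ Unique-─ x∈xs u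

  ─-fresh : ∀ {xs} (x∈xs : x ∈ xs) → Unique xs → All (x ≢_) (xs ─ x∈xs)
  ─-fresh (here refl)  (x∉ ∷ _) = x∉
  ─-fresh (there x∈xs) (y∉ ∷ u) = ≢-sym (All.lookup y∉ x∈xs) ∷ ─-fresh x∈xs u

module _ {m : ℕ} where

  sum-─ : ∀ (a : ℕ → ℕ) {is} (m∈is : m ∈ is) → sum (map a is) ≡ a m + sum (map a (is ─ m∈is))
  sum-─ a (here refl)          = refl
  sum-─ a (there {x = i} m∈is) =
    trans (cong (a i +_) (sum-─ a m∈is)) (x∙yz≈y∙xz (a i) (a m) _)

  <-suc-avoiding : ∀ {is} → All (_< suc m) is → All (m ≢_) is → All (_< m) is
  <-suc-avoiding is<1+m m∉is =
    All.zipWith (λ (i<1+m , m≢i) → ≤∧≢⇒< (s≤s⁻¹ i<1+m) (≢-sym m≢i)) (is<1+m , m∉is)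

Adjoin : ℕ → (ℕ → Set) → ℕ → Set
Adjoin s X n = X n ⊎ ∃[ x ] X x × n ≡ s + x

InPFirst-suc : ∀ a m n → InPFirst a (suc m) n ⇔ Adjoin (a m) (InPFirst a m) n
InPFirst-suc a m n = mk⇔ split join
  where
  split : InPFirst a (suc m) n → Adjoin (a m) (InPFirst a m) n
  split (is , u , is<1+m , Σis≡n) with m ∈? is
  ... | no  m∉is = inj₁ (is , u , <-suc-avoiding is<1+m (¬Any⇒All¬ is m∉is) , Σis≡n)
  ... | yes m∈is = inj₂ (_ , (is ─ m∈is , Unique-─ m∈is u , rest<m , refl) ,
                         trans (sym Σis≡n) (sum-─ a m∈is))
    where rest<m = <-suc-avoiding (All.─⁺ m∈is is<1+m) (─-fresh m∈is u)
  join : Adjoin (a m) (InPFirst a m) n → InPFirst a (suc m) n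
  join (inj₁ (is , u , is<m , Σis≡n)) = is , u , All.map m<n⇒m<1+n is<m , Σis≡n
  join (inj₂ (x , (is , u , is<m , Σis≡x) , refl)) =
    m ∷ is , All.map >⇒≢ is<m ∷ u , n<1+n m ∷ All.map m<n⇒m<1+n is<m , cong (a m +_) Σis≡x

InPFirst⇒InP : ∀ {a m n} → InPFirst a m n → InP a n
InPFirst⇒InP (is , u , is<m , Σis≡n) = is , u , All.map (λ _ → tt) is<m , Σis≡n

module _ {a : ℕ → ℕ} (a↑ : StrictlyIncreasing a) where

  InP⇒InPFirst : ∀ {m n} → n < a m → InP a n → InPFirst a m n
  InP⇒InPFirst {m} {n} n<am (is , u , _ , Σis≡n) =
    is , u , All.map index<m (summands≤sum a is) , Σis≡n
    where
    index<m : ∀ {i} → a i ≤ sum (map a is) → i < m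
    index<m {i} ai≤Σ = ≰⇒> λ m≤i →
      <⇒≱ n<am (≤-trans (strictlyIncreasing⇒mono-≤ a↑ m≤i) (subst (a i ≤_) Σis≡n ai≤Σ))

  InP∖InPFirst⇒≤ : ∀ {m n} → InP a n → ¬ InPFirst a m n → a m ≤ n
  InP∖InPFirst⇒≤ n∈P n∉Pm = ≮⇒≥ λ n<am → n∉Pm (InP⇒InPFirst n<am n∈P)

Adjoin-resp : ∀ {s t} {X Y : ℕ → Set} → s ≡ t → (∀ n → X n ⇔ Y n) →
              ∀ n → Adjoin s X n ⇔ Adjoin t Y n
Adjoin-resp refl X⇔Y n = mk⇔
  (Sum.map (to (X⇔Y n)) (Product.map₂ (Product.map₁ (to (X⇔Y _)))))
  (Sum.map (from (X⇔Y n)) (Product.map₂ (Product.map₁ (from (X⇔Y _)))))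

Adjoin-char : ∀ {s} {X Y : ℕ → Set} → Decidable X →
              (∀ {n} → X n → Y n) → (∀ {x} → X x → Y (s + x)) →
              (∀ {n} → Y n → ¬ X n → ∃[ x ] X x × n ≡ s + x) →
              ∀ n → Adjoin s X n ⇔ Y n
Adjoin-char {X = X} {Y} X? X⊆Y s+X⊆Y Y∖X⊆s+X n = mk⇔ [ X⊆Y , (λ { (_ , Xx , refl) → s+X⊆Y Xx }) ] back
  where
  back : Y n → Adjoin _ X n
  back Yn with X? n
  ... | yes Xn = inj₁ Xn
  ... | no ¬Xn = inj₂ (Y∖X⊆s+X Yn ¬Xn)

[0,_]∖｛_｝ : ℕ → ℕ → ℕ → Set
[0, L ]∖｛ c ｝ n = n ≤ L × n ≢ c

[0,_]∖｛_｝∖｛_｝ : ℕ → ℕ → ℕ → ℕ → Set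
[0, L ]∖｛ c ｝∖｛ h ｝ n = n ≤ L × n ≢ c × n ≢ h

[0,_]∖｛_｝? : ∀ L c → Decidable [0, L ]∖｛ c ｝
[0, L ]∖｛ c ｝? n = n ≤? L ×-dec ¬? (n ≟ c)

[0,_]∖｛_｝∖｛_｝? : ∀ L c h → Decidable [0, L ]∖｛ c ｝∖｛ h ｝
[0, L ]∖｛ c ｝∖｛ h ｝? n = n ≤? L ×-dec ¬? (n ≟ c) ×-dec ¬? (n ≟ h)

2*n≡n+n : ∀ n → 2 * n ≡ n + n
2*n≡n+n n = cong (n +_) (+-identityʳ n)

module _ (c : ℕ) where

  Adjoin-<c : ∀ n → Adjoin (suc c) (_< c) n ⇔ [0, 2 * c ]∖｛ c ｝ n
  Adjoin-<c = Adjoin-char (_<? c) below shifted rest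
    where
    below : ∀ {n} → n < c → [0, 2 * c ]∖｛ c ｝ n
    below n<c = ≤-trans (<⇒≤ n<c) (m≤m+n c _) , <⇒≢ n<c
    shifted : ∀ {x} → x < c → [0, 2 * c ]∖｛ c ｝ (suc c + x)
    shifted {x} x<c =
      subst₂ _≤_ (+-suc c x) (sym (2*n≡n+n c)) (+-monoʳ-≤ c x<c) , ≢-sym (m≢1+m+n c)
    rest : ∀ {n} → [0, 2 * c ]∖｛ c ｝ n → ¬ n < c → ∃[ x ] x < c × n ≡ suc c + x
    rest {n} (n≤2c , n≢c) n≮c with m≤n⇒∃[o]m+o≡n (≤∧≢⇒< (≮⇒≥ n≮c) (≢-sym n≢c))
    ... | x , refl = x , +-cancelˡ-≤ c _ _ (subst₂ _≤_ (sym (+-suc c x)) (2*n≡n+n c) n≤2c) , refl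

  module _ {d : ℕ} (c<d : c < d) where

    Adjoin-[0,2c]∖c : d ≤ 2 * c + 1 →
      ∀ n → Adjoin d [0, 2 * c ]∖｛ c ｝ n ⇔ [0, d + 2 * c ]∖｛ c ｝∖｛ d + c ｝ n
    Adjoin-[0,2c]∖c d≤2c+1 = Adjoin-char ([0, 2 * c ]∖｛ c ｝?) below shifted rest
      where
      2c<d+c : 2 * c < d + c
      2c<d+c = subst (_< d + c) (sym (2*n≡n+n c)) (+-monoˡ-< c c<d)
      below : ∀ {n} → [0, 2 * c ]∖｛ c ｝ n → [0, d + 2 * c ]∖｛ c ｝∖｛ d + c ｝ n
      below (n≤2c , n≢c) = ≤-trans n≤2c (m≤n+m _ d) , n≢c , <⇒≢ (≤-<-trans n≤2c 2c<d+c)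
      shifted : ∀ {x} → [0, 2 * c ]∖｛ c ｝ x → [0, d + 2 * c ]∖｛ c ｝∖｛ d + c ｝ (d + x)
      shifted {x} (x≤2c , x≢c) =
        +-monoʳ-≤ d x≤2c , >⇒≢ (<-≤-trans c<d (m≤m+n d x)) , x≢c ∘ +-cancelˡ-≡ d x c
      rest : ∀ {n} → [0, d + 2 * c ]∖｛ c ｝∖｛ d + c ｝ n → ¬ [0, 2 * c ]∖｛ c ｝ n →
             ∃[ x ] [0, 2 * c ]∖｛ c ｝ x × n ≡ d + x
      rest {n} (n≤d+2c , n≢c , n≢d+c) n∉X with m≤n⇒∃[o]m+o≡n d≤n
        where
        d≤n : d ≤ n
        d≤n = ≮⇒≥ λ n<d → n∉X (m<1+n⇒m≤n (<-≤-trans n<d (subst (d ≤_) (+-comm _ 1) d≤2c+1)) , n≢c)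
      ... | x , refl = x , (+-cancelˡ-≤ d _ _ n≤d+2c , n≢d+c ∘ cong (d +_)) , refl

    Adjoin-[0,d+2c]∖c∖d+c : ∀ {e} → d < e → e ≤ d + c →
      ∀ n → Adjoin e [0, d + 2 * c ]∖｛ c ｝∖｛ d + c ｝ n
          ⇔ [0, e + d + 2 * c ]∖｛ c ｝∖｛ e + d + c ｝ n
    Adjoin-[0,d+2c]∖c∖d+c {e} d<e e≤d+c =
      Adjoin-char ([0, d + 2 * c ]∖｛ c ｝∖｛ d + c ｝?) below shifted rest
      where
      c<e : c < e
      c<e = <-trans c<d d<e
      d+2c≡d+c+c : d + 2 * c ≡ d + c + c
      d+2c≡d+c+c = trans (cong (d +_) (2*n≡n+n c)) (sym (+-assoc d c c))
      d+2c<e+d+c : d + 2 * c < e + d + c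
      d+2c<e+d+c = subst₂ _<_ (sym d+2c≡d+c+c) (trans (+-comm (d + c) e) (sym (+-assoc e d c)))
                     (+-monoʳ-< (d + c) c<e)
      below : ∀ {n} → [0, d + 2 * c ]∖｛ c ｝∖｛ d + c ｝ n →
              [0, e + d + 2 * c ]∖｛ c ｝∖｛ e + d + c ｝ n
      below (n≤d+2c , n≢c , _) =
        ≤-trans n≤d+2c (+-monoˡ-≤ (2 * c) (m≤n+m d e)) , n≢c , <⇒≢ (≤-<-trans n≤d+2c d+2c<e+d+c)
      shifted : ∀ {x} → [0, d + 2 * c ]∖｛ c ｝∖｛ d + c ｝ x →
                [0, e + d + 2 * c ]∖｛ c ｝∖｛ e + d + c ｝ (e + x)
      shifted {x} (x≤d+2c , _ , x≢d+c) =
        subst (e + x ≤_) (sym (+-assoc e d (2 * c))) (+-monoʳ-≤ e x≤d+2c) ,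
        >⇒≢ (<-≤-trans c<e (m≤m+n e x)) ,
        x≢d+c ∘ +-cancelˡ-≡ e x (d + c) ∘ (λ eq → trans eq (+-assoc e d c))
      e+c∈X : [0, d + 2 * c ]∖｛ c ｝∖｛ d + c ｝ (e + c)
      e+c∈X = subst (e + c ≤_) (sym d+2c≡d+c+c) (+-monoˡ-≤ c e≤d+c) ,
              >⇒≢ (<-≤-trans c<e (m≤m+n e c)) ,
              >⇒≢ d<e ∘ +-cancelʳ-≡ c e d
      rest : ∀ {n} → [0, e + d + 2 * c ]∖｛ c ｝∖｛ e + d + c ｝ n →
             ¬ [0, d + 2 * c ]∖｛ c ｝∖｛ d + c ｝ n →
             ∃[ x ] [0, d + 2 * c ]∖｛ c ｝∖｛ d + c ｝ x × n ≡ e + x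
      rest {n} (n≤e+d+2c , n≢c , n≢e+d+c) n∉X with m≤n⇒∃[o]m+o≡n e≤n
        where
        e≤n : e ≤ n
        e≤n = ≮⇒≥ λ n<e → n∉X (≤-trans (<⇒≤ (<-≤-trans n<e e≤d+c)) (+-monoʳ-≤ d (m≤m+n c _)) ,
                                n≢c , <⇒≢ (<-≤-trans n<e e≤d+c))
      ... | x , refl =
        x , (+-cancelˡ-≤ e _ _ (subst (e + x ≤_) (+-assoc e d (2 * c)) n≤e+d+2c) ,
             (λ x≡c → n∉X (subst (λ y → [0, d + 2 * c ]∖｛ c ｝∖｛ d + c ｝ (e + y)) (sym x≡c) e+c∈X)) ,
             n≢e+d+c ∘ (λ x≡d+c → trans (cong (e +_) x≡d+c) (sym (+-assoc e d c)))) ,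
        refl

3n+1≡2n+1+n : ∀ n → 3 * n + 1 ≡ 2 * n + 1 + n
3n+1≡2n+1+n = solve-∀

InPFirst-suc-⇔ : ∀ {a m s} {X Y : ℕ → Set} → a m ≡ s → (∀ n → InPFirst a m n ⇔ X n) →
                 (∀ n → Adjoin s X n ⇔ Y n) → ∀ n → InPFirst a (suc m) n ⇔ Y n
InPFirst-suc-⇔ am≡s Pm⇔X Adjoin⇔Y n =
  Adjoin⇔Y n ⇔-∘ (Adjoin-resp am≡s Pm⇔X n ⇔-∘ InPFirst-suc _ _ n)

module FirstGaps {a b : ℕ → ℕ} (a↑ : StrictlyIncreasing a) (b↑ : StrictlyIncreasing b)
                 (0<a₀ : 0 < a 0) (P⇔∁B : ∀ n → InP a n ⇔ (¬ InSeq b n))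
                 {k : ℕ} (Pk⇔<b₀ : ∀ n → InPFirst a k n ⇔ (n < b 0))
                 (3b₀+5≤b₁ : 3 * b 0 + 5 ≤ b 1) where

  private
    c : ℕ
    c = b 0

  bⱼ∉P : ∀ j → ¬ InP a (b j)
  bⱼ∉P j bⱼ∈P = to (P⇔∁B _) bⱼ∈P (j , refl)

  InP-<b₁ : ∀ {n} → n < b 1 → n ≢ c → InP a n
  InP-<b₁ n<b₁ n≢c = from (P⇔∁B _) λ where
    (zero  , c≡n)  → n≢c (sym c≡n)
    (suc j , bⱼ≡n) → <⇒≱ n<b₁ (subst (b 1 ≤_) bⱼ≡n (strictlyIncreasing⇒mono-≤ b↑ (s≤s z≤n)))

  gap-bound : ∀ {m n} → n ≤ 2 * c + 1 + c → n ≢ c → ¬ InPFirst a m n → a m ≤ n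
  gap-bound {n = n} n≤3c+1 = InP∖InPFirst⇒≤ a↑ ∘ InP-<b₁ (≤-<-trans n≤3c+1 2c+1+c<b₁)
    where
    2c+1+c<b₁ : 2 * c + 1 + c < b 1
    2c+1+c<b₁ = subst (_< b 1) (3n+1≡2n+1+n c) (<-≤-trans (+-monoʳ-< (3 * c) (s≤s (s≤s z≤n))) 3b₀+5≤b₁)

  c<a-k : c < a k
  c<a-k = ≰⇒> λ a-k≤c → let x , a-k+x≡c = m≤n⇒∃[o]m+o≡n a-k≤c in
    bⱼ∉P 0 (InPFirst⇒InP (from (InPFirst-suc a k c)
      (inj₂ (x , from (Pk⇔<b₀ x) (subst (x <_) a-k+x≡c (m<n+m x 0<a-k)) , sym a-k+x≡c))))
    where
    0<a-k : 0 < a k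
    0<a-k = <-≤-trans 0<a₀ (strictlyIncreasing⇒mono-≤ a↑ z≤n)

  a-k≡1+c : a k ≡ suc c
  a-k≡1+c = ≤-antisym (gap-bound (+-monoˡ-≤ c (m≤n+m 1 (2 * c))) 1+n≢n
                         (<-asym (n<1+n c) ∘ to (Pk⇔<b₀ _)))
                      c<a-k

  Pk+1 : ∀ n → InPFirst a (1 + k) n ⇔ [0, 2 * c ]∖｛ c ｝ n
  Pk+1 = InPFirst-suc-⇔ a-k≡1+c Pk⇔<b₀ (Adjoin-<c c)

  c<a-k+1 : c < a (1 + k)
  c<a-k+1 = <-trans c<a-k (a↑ k)

  a-k+1≤2c+1 : a (1 + k) ≤ 2 * c + 1
  a-k+1≤2c+1 = gap-bound (m≤m+n _ c) (>⇒≢ (≤-<-trans (m≤m+n c _) 2c<2c+1))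
                         (<⇒≱ 2c<2c+1 ∘ proj₁ ∘ to (Pk+1 _))
    where
    2c<2c+1 : 2 * c < 2 * c + 1
    2c<2c+1 = m<m+n (2 * c) z<s

  Pk+2 : ∀ n → InPFirst a (2 + k) n ⇔ [0, a (1 + k) + 2 * c ]∖｛ c ｝∖｛ a (1 + k) + c ｝ n
  Pk+2 = InPFirst-suc-⇔ refl Pk+1 (Adjoin-[0,2c]∖c c c<a-k+1 a-k+1≤2c+1)

  a-k+2≤a-k+1+c : a (2 + k) ≤ a (1 + k) + c
  a-k+2≤a-k+1+c = gap-bound (+-monoˡ-≤ c a-k+1≤2c+1) (>⇒≢ (<-≤-trans c<a-k+1 (m≤m+n _ c)))
                            (λ p → proj₂ (proj₂ (to (Pk+2 _) p)) refl)

  Pk+3 : ∀ n → InPFirst a (3 + k) n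
               ⇔ [0, a (2 + k) + a (1 + k) + 2 * c ]∖｛ c ｝∖｛ a (2 + k) + a (1 + k) + c ｝ n
  Pk+3 = InPFirst-suc-⇔ refl Pk+2 (Adjoin-[0,d+2c]∖c∖d+c c c<a-k+1 (a↑ (1 + k)) a-k+2≤a-k+1+c)

  a-k+2+a-k+1+c≤b₁ : a (2 + k) + a (1 + k) + c ≤ b 1
  a-k+2+a-k+1+c≤b₁ = ≮⇒≥ λ b₁<s → bⱼ∉P 1 (InPFirst⇒InP (from (Pk+3 _)
    (≤-trans (<⇒≤ b₁<s) (+-monoʳ-≤ (a (2 + k) + a (1 + k)) (m≤m+n c _)) , >⇒≢ (b↑ 0) , <⇒≢ b₁<s)))

-- The hypothesis 1 < b 0 is not needed.
lemma2p2 : (a b : ℕ → ℕ) →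
  StrictlyIncreasing a → StrictlyIncreasing b →
  0 < a 0 → 1 < b 0 →
  (∀ n → InP a n ⇔ (¬ InSeq b n)) →
  (k : ℕ) → (∀ n → InPFirst a k n ⇔ (n < b 0)) →
  3 * b 0 + 5 ≤ b 1 →
  (a k ≡ b 0 + 1
    × a (1 + k) ≤ 2 * b 0 + 1
    × a (2 + k) ≤ a (1 + k) + b 0
    × a (2 + k) + a (1 + k) + b 0 ≤ b 1)
  × (∀ n → InPFirst a (3 + k) n ⇔
       (n ≤ a (2 + k) + a (1 + k) + 2 * b 0
        × n ≢ b 0
        × n ≢ a (2 + k) + a (1 + k) + b 0))
lemma2p2 a b a↑ b↑ 0<a₀ _ P⇔∁B k Pk⇔<b₀ 3b₀+5≤b₁ =
  (trans a-k≡1+c (+-comm 1 (b 0)) , a-k+1≤2c+1 , a-k+2≤a-k+1+c , a-k+2+a-k+1+c≤b₁) , Pk+3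
  where open FirstGaps a↑ b↑ 0<a₀ P⇔∁B Pk⇔<b₀ 3b₀+5≤b₁
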